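{- OBFOL is strictly less expressive than CBFOL and than DBFOL: every OBFOL sentence is a CBFOL sentence and a DBFOL sentence, and there exist a language signature $\Sigma$ and a CBFOL sentence over $\Sigma(\mathrm{Var})$ that is not equivalent to any OBFOL sentence over $\Sigma(\mathrm{Var})$, and likewise a DBFOL sentence over $\Sigma(\mathrm{Var})$ not equivalent to any OBFOL sentence over $\Sigma(\mathrm{Var})$.
   Context: Language signature $\Sigma=(\mathrm{Args},\mathrm{Rels},\mathrm{ar})$: $\mathrm{Args},\mathrm{Rels}$ finite non-empty, $\mathrm{ar}:\mathrm{Rels}\to\mathcal P(\mathrm{Args})\setminus\{\emptyset\}$. A $\Sigma$-structure $\mathcal R=(D,\cdot^{\mathcal R})$: $D$ non-empty, $r^{\mathcal R}$ a set of functions $\mathrm{ar}(r)\to D$. FOL formulas over $\Sigma(\mathrm{Var})$: $\varphi::= r\mid\neg\varphi\mid\varphi\wedge\varphi\mid\varphi\vee\varphi\mid\exists x.\varphi\mid\forall x.\varphi\mid(a,x)\varphi$. Free placeholders: $\mathrm{free}(r)=\mathrm{ar}(r)$; unchanged by $\neg$; union for $\wedge,\vee$; $\mathrm{free}(Qx.\varphi)=\mathrm{free}(\varphi)\setminus\{x\}$; $\mathrm{free}((a,x)\varphi)=(\mathrm{free}(\varphi)\setminus\{a\})\cup\{x\}$ if $a\in\mathrm{free}(\varphi)$, else $\mathrm{free}(\varphi)$; sentences have none. Semantics: $\mathcal R,\chi\models r$ iff $\chi|_{\mathrm{ar}(r)}\in r^{\mathcal R}$; usual Boolean and quantifier clauses;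 $\mathcal R,\chi\models(a,x)\varphi$ iff $\mathcal R,\chi[a\mapsto\chi(x)]\models\varphi$; $\mathcal R\models\varphi$ iff $\mathcal R,\emptyset\models\varphi$. Two sentences are equivalent iff they have the same models. Quantification prefix: finite word over $\{\exists x,\forall x\}$, each variable at most once; binding prefix: finite word over pairs $(a,x)$, each argument at most once; derived relation: Boolean combination of relations all with the same argument set. Fragments: $\varphi::=\wp\psi\mid(\varphi\wedge\varphi)\mid(\varphi\vee\varphi)$ where, for CBFOL, $\psi::=\flat\bar r\mid(\psi\wedge\psi)$; for DBFOL, $\psi::=\flat\bar r\mid(\psi\vee\psi)$; for OBFOL, $\psi::=\flat\bar r$ ($\wp$ quantification prefix, $\flat$ binding prefix, $\bar r$ derived relation). -}

module Defs where

open import Data.Nat using (ℕ; suc)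
open import Data.Fin using (Fin)
import Data.Fin as F
import Data.Nat as N
open import Data.Fin.Subset using (Subset; _∈_; Nonempty)
open import Data.Maybe using (Maybe; just; nothing)
open import Data.Product using (Σ; _×_; _,_; proj₁; proj₂; ∃)
open import Data.Sum using (_⊎_; inj₁; inj₂)
open import Data.Sum.Properties using (≡-dec)
open import Data.List using (List; map)
open import Data.List.Relation.Unary.Unique.Propositional using (Unique)
open import Relation.Nullary using (¬_; yes; no)
open import Relation.Binary.PropositionalEquality using (_≡_; _≢_)

Var : Set
Var = ℕ

-- Language signature: Args = Fin (suc na), Rels = Fin (suc nr) (finite, non-empty),
-- ar : Rels → P(Args) \ {∅}.
record Signature : Set where
  field
    na : ℕ
    nr : ℕ
    ar : Fin (suc nr) → Subset (suc na)
    ar-nonempty : ∀ r → Nonempty (ar r)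

module _ (Sig : Signature) where
  open Signature Sig

  Arg : Set
  Arg = Fin (suc na)

  Rel : Set
  Rel = Fin (suc nr)

  ArgsOf : Rel → Set
  ArgsOf r = Σ Arg (λ a → a ∈ ar r)

  -- Σ-structure: non-empty domain D, each r interpreted as a set of functions ar(r) → D
  -- (a predicate on such functions, required to be extensional so it is a set of functions).
  record Structure : Set₁ where
    field
      D : Set
      d₀ : D
      interp : (r : Rel) → (ArgsOf r → D) → Set
      interp-ext : ∀ r (f g : ArgsOf r → D) → (∀ i → f i ≡ g i) → interp r f → interp r g

  data Formula : Set where
    rel  : Rel → Formula
    neg  : Formula → Formula
    conj : Formula → Formula → Formula
    disj : Formula → Formula → Formula
    ex   : Var → Formula → Formula
    all  : Var → Formula → Formula
    bind : Arg → Var → Formula → Formula   -- (a , x) φ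

  Placeholder : Set
  Placeholder = Arg ⊎ Var

  Free : Placeholder → Formula → Set
  Free (inj₁ a) (rel r) = a ∈ ar r
  Free (inj₂ x) (rel r) = Data.Empty.⊥
    where import Data.Empty
  Free p (neg φ) = Free p φ
  Free p (conj φ ψ) = Free p φ ⊎ Free p ψ
  Free p (disj φ ψ) = Free p φ ⊎ Free p ψ
  Free p (ex x φ) = Free p φ × p ≢ inj₂ x
  Free p (all x φ) = Free p φ × p ≢ inj₂ x
  Free p (bind a x φ) = (Free p φ × p ≢ inj₁ a) ⊎ (Free (inj₁ a) φ × p ≡ inj₂ x)

  Sentence : Formula → Set
  Sentence φ = ∀ p → ¬ Free p φ

  module _ (R : Structure) where
    open Structure R

    Assignment : Set
    Assignment = Placeholder → Maybe D

    update : Assignment → Placeholder → Maybe D → Assignment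
    update χ p v q with ≡-dec F._≟_ N._≟_ p q
    ... | yes _ = v
    ... | no _ = χ q

    Sat : Assignment → Formula → Set
    Sat χ (rel r) = Σ (ArgsOf r → D) (λ g → (∀ i → χ (inj₁ (proj₁ i)) ≡ just (g i)) × interp r g)
    Sat χ (neg φ) = ¬ Sat χ φ
    Sat χ (conj φ ψ) = Sat χ φ × Sat χ ψ
    Sat χ (disj φ ψ) = Sat χ φ ⊎ Sat χ ψ
    Sat χ (ex x φ) = Σ D (λ d → Sat (update χ (inj₂ x) (just d)) φ)
    Sat χ (all x φ) = (d : D) → Sat (update χ (inj₂ x) (just d)) φ
    Sat χ (bind a x φ) = Sat (update χ (inj₁ a) (χ (inj₂ x))) φ

    Models : Formula → Set
    Models φ = Sat (λ _ → nothing) φ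

  Equivalent : Formula → Formula → Set₁
  Equivalent φ ψ = (R : Structure) → (Models R φ → Models R ψ) × (Models R ψ → Models R φ)

  data Quant : Set where
    ∃q ∀q : Quant

  QPrefix : Set
  QPrefix = List (Quant × Var)

  applyQ : QPrefix → Formula → Formula
  applyQ List.[] φ = φ
  applyQ ((∃q , x) List.∷ w) φ = ex x (applyQ w φ)
  applyQ ((∀q , x) List.∷ w) φ = all x (applyQ w φ)

  IsQPrefix : QPrefix → Set
  IsQPrefix w = Unique (map proj₂ w)

  BPrefix : Set
  BPrefix = List (Arg × Var)

  applyB : BPrefix → Formula → Formula
  applyB List.[] φ = φ
  applyB ((a , x) List.∷ b) φ = bind a x (applyB b φ)

  IsBPrefix : BPrefix → Set
  IsBPrefix b = Unique (map proj₁ b)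

  data DerivedOn (S : Subset (suc na)) : Formula → Set where
    d-rel  : ∀ r → ar r ≡ S → DerivedOn S (rel r)
    d-neg  : ∀ {φ} → DerivedOn S φ → DerivedOn S (neg φ)
    d-conj : ∀ {φ ψ} → DerivedOn S φ → DerivedOn S ψ → DerivedOn S (conj φ ψ)
    d-disj : ∀ {φ ψ} → DerivedOn S φ → DerivedOn S ψ → DerivedOn S (disj φ ψ)

  Derived : Formula → Set
  Derived φ = ∃ λ S → DerivedOn S φ

  BoundDerived : Formula → Set
  BoundDerived φ = Σ BPrefix (λ b → IsBPrefix b × Σ Formula (λ ψ → Derived ψ × φ ≡ applyB b ψ))

  data CBody : Formula → Set where
    cb-atom : ∀ {φ} → BoundDerived φ → CBody φ
    cb-conj : ∀ {φ ψ} → CBody φ → CBody ψ → CBody (conj φ ψ)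

  data DBody : Formula → Set where
    db-atom : ∀ {φ} → BoundDerived φ → DBody φ
    db-disj : ∀ {φ ψ} → DBody φ → DBody ψ → DBody (disj φ ψ)

  OBody : Formula → Set
  OBody = BoundDerived

  data Frag (Body : Formula → Set) : Formula → Set where
    f-pre  : ∀ (w : QPrefix) {ψ} → IsQPrefix w → Body ψ → Frag Body (applyQ w ψ)
    f-conj : ∀ {φ ψ} → Frag Body φ → Frag Body ψ → Frag Body (conj φ ψ)
    f-disj : ∀ {φ ψ} → Frag Body φ → Frag Body ψ → Frag Body (disj φ ψ)

  CBFOL-sentence DBFOL-sentence OBFOL-sentence : Formula → Set
  CBFOL-sentence φ = Sentence φ × Frag CBody φ
  DBFOL-sentence φ = Sentence φ × Frag DBody φ
  OBFOL-sentence φ = Sentence φ × Frag OBody φ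

module Submission where

-- The inclusions hold because the OBFOL body grammar ψ ::= ♭r̄ is the base case of both
-- the CBFOL and the DBFOL body grammars, and the fragment grammar is monotone in its body.
--
-- For strictness the key observation is that every component ℘♭r̄ of an OBFOL sentence
-- mentions only relations of one single argument set S. Hence two structures which are
-- isomorphic "arity by arity" (for each S via a possibly different bijection of the
-- domains) satisfy the same OBFOL sentences; this is a transfer lemma for formulas whose
-- relation symbols are all preserved by one bijection.
--
-- The counterexample uses two arguments a, b and unary relations r_a, r_b of arities
-- {a}, {b}, over the domain Bool. In R₁ both relations hold of true only; in R₂, r_a holds
-- of true and r_b of false. The identity handles r_a and negation handles r_b, so R₁ and
-- R₂ agree on all OBFOL sentences, while the CBFOL sentence ∃x.((a,x)r_a ∧ (b,x)r_b) and
-- the DBFOL sentence ∀x.((a,x)r_a ∨ (b,x)r_b) each separate them.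

open import Defs
open import Data.Bool using (Bool; true; false; not)
open import Data.Bool.Properties using (not-involutive)
open import Data.Empty using (⊥-elim)
open import Data.Fin using (Fin; zero; suc)
import Data.Fin as Fin
open import Data.Fin.Subset using (⁅_⁆; _∈_)
open import Data.Fin.Subset.Properties using (x∈⁅x⁆; x∈⁅y⁆⇒x≡y)
open import Data.List using ([]; _∷_)
open import Data.List.Relation.Unary.All using ([])
open import Data.List.Relation.Unary.AllPairs using ([]; _∷_)
open import Data.Maybe using (just; nothing)
import Data.Maybe as Maybe
import Data.Nat as ℕ
open import Data.Product using (Σ; _×_; _,_; proj₁; proj₂)
open import Data.Product.Function.Dependent.Propositional using (Σ-⇔)
open import Data.Product.Function.NonDependent.Propositional using (_×-⇔_)
open import Data.Sum using (inj₁; inj₂; [_,_]′)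
open import Data.Sum.Function.Propositional using (_⊎-⇔_)
open import Data.Sum.Properties using (≡-dec)
open import Function using (_∘_)
open import Function.Bundles using (_⇔_; _↔_; mk⇔; mk↔ₛ′; Equivalence; Inverse; Injection)
open import Function.Properties.Equivalence using () renaming (sym to ⇔-sym)
open import Function.Properties.Inverse using (↔-refl; ↔⇒↠; Inverse⇒Injection)
open import Function.Related.TypeIsomorphisms using (¬-cong-⇔)
open import Relation.Nullary using (¬_; yes; no)
open import Relation.Binary.PropositionalEquality using (_≡_; refl; sym; trans; cong; subst)

open Signature using (ar)
open Structure using (D; interp; interp-ext)
open Equivalence using (to; from)

Frag-mono : ∀ {Sig} {Body Body′ : Formula Sig → Set} →
            (∀ {ψ} → Body ψ → Body′ ψ) → ∀ {φ} → Frag Sig Body φ → Frag Sig Body′ φ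
Frag-mono embed (f-pre w prefix body) = f-pre w prefix (embed body)
Frag-mono embed (f-conj φ ψ)          = f-conj (Frag-mono embed φ) (Frag-mono embed ψ)
Frag-mono embed (f-disj φ ψ)          = f-disj (Frag-mono embed φ) (Frag-mono embed ψ)

OBFOL⊆CBFOL : ∀ Sig {φ} → OBFOL-sentence Sig φ → CBFOL-sentence Sig φ
OBFOL⊆CBFOL Sig (closed , frag) = closed , Frag-mono cb-atom frag

OBFOL⊆DBFOL : ∀ Sig {φ} → OBFOL-sentence Sig φ → DBFOL-sentence Sig φ
OBFOL⊆DBFOL Sig (closed , frag) = closed , Frag-mono db-atom frag

OnlyRels : ∀ {Sig} → (Rel Sig → Set) → Formula Sig → Set
OnlyRels Ok (rel r)      = Ok r
OnlyRels Ok (neg φ)      = OnlyRels Ok φ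
OnlyRels Ok (conj φ ψ)   = OnlyRels Ok φ × OnlyRels Ok ψ
OnlyRels Ok (disj φ ψ)   = OnlyRels Ok φ × OnlyRels Ok ψ
OnlyRels Ok (ex x φ)     = OnlyRels Ok φ
OnlyRels Ok (all x φ)    = OnlyRels Ok φ
OnlyRels Ok (bind a x φ) = OnlyRels Ok φ

applyQ-only : ∀ {Sig} {Ok : Rel Sig → Set} w {φ} → OnlyRels Ok φ → OnlyRels Ok (applyQ Sig w φ)
applyQ-only []              only = only
applyQ-only ((∃q , _) ∷ w) only = applyQ-only w only
applyQ-only ((∀q , _) ∷ w) only = applyQ-only w only

applyB-only : ∀ {Sig} {Ok : Rel Sig → Set} b {φ} → OnlyRels Ok φ → OnlyRels Ok (applyB Sig b φ)
applyB-only []      only = only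
applyB-only (_ ∷ b) only = applyB-only b only

derived-only : ∀ {Sig S φ} → DerivedOn Sig S φ → OnlyRels (λ r → ar Sig r ≡ S) φ
derived-only (d-rel r arity) = arity
derived-only (d-neg d)       = derived-only d
derived-only (d-conj d d′)   = derived-only d , derived-only d′
derived-only (d-disj d d′)   = derived-only d , derived-only d′

derived-witness : ∀ {Sig S φ} → DerivedOn Sig S φ → Σ (Rel Sig) (λ r → ar Sig r ≡ S)
derived-witness (d-rel r arity) = r , arity
derived-witness (d-neg d)       = derived-witness d
derived-witness (d-conj d _)    = derived-witness d
derived-witness (d-disj d _)    = derived-witness d

Π-⇔ : ∀ {I J : Set} {A : I → Set} {B : J → Set} (h : I ↔ J) →
      (∀ {i} → A i ⇔ B (Inverse.to h i)) → ((i : I) → A i) ⇔ ((j : J) → B j)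
Π-⇔ {B = B} h A⇔B = mk⇔
  (λ f j → subst B (Inverse.strictlyInverseˡ h j) (to A⇔B (f (Inverse.from h j))))
  (λ g i → from A⇔B (g (Inverse.to h i)))

update-same : ∀ {Sig} (R : Structure Sig) χ p m → update Sig R χ p m p ≡ m
update-same R χ p m with ≡-dec Fin._≟_ ℕ._≟_ p p
... | yes _  = refl
... | no p≢p = ⊥-elim (p≢p refl)

module Transfer {Sig : Signature} (R R′ : Structure Sig) (h : D R ↔ D R′)
  (Ok : Rel Sig → Set)
  (preserves : ∀ {r} → Ok r → ∀ g → interp R r g ⇔ interp R′ r (Inverse.to h ∘ g)) where

  open Inverse h using () renaming (to to h→; from to h←)

  Related : Assignment Sig R → Assignment Sig R′ → Set
  Related χ χ′ = ∀ p → χ′ p ≡ Maybe.map h→ (χ p)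

  related-update : ∀ {χ χ′} → Related χ χ′ → ∀ p {m m′} → m′ ≡ Maybe.map h→ m →
                   Related (update Sig R χ p m) (update Sig R′ χ′ p m′)
  related-update related p m′≡ q with ≡-dec Fin._≟_ ℕ._≟_ p q
  ... | yes _ = m′≡
  ... | no _  = related q

  map-just : ∀ m {y} → Maybe.map h→ m ≡ just y → m ≡ just (h← y)
  map-just (just d) refl = cong just (sym (Inverse.strictlyInverseʳ h d))

  transfer-rel : ∀ r → Ok r → ∀ {χ χ′} → Related χ χ′ →
                 Sat Sig R χ (rel r) ⇔ Sat Sig R′ χ′ (rel r)
  transfer-rel r ok {χ} {χ′} related = mk⇔
    (λ (g , defined , holds) →
        h→ ∘ g
      , (λ i → trans (related _) (cong (Maybe.map h→) (defined i)))
      , to (preserves ok g) holds)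
    (λ (g′ , defined′ , holds′) →
        h← ∘ g′
      , (λ i → map-just (χ _) (trans (sym (related _)) (defined′ i)))
      , from (preserves ok (h← ∘ g′))
          (interp-ext R′ r g′ (h→ ∘ h← ∘ g′)
             (λ i → sym (Inverse.strictlyInverseˡ h (g′ i))) holds′))

  transfer : ∀ φ → OnlyRels Ok φ → ∀ {χ χ′} → Related χ χ′ →
             Sat Sig R χ φ ⇔ Sat Sig R′ χ′ φ
  transfer (rel r)      ok {χ} {χ′} related = transfer-rel r ok {χ} {χ′} related
  transfer (neg φ)      ok         related = ¬-cong-⇔ (transfer φ ok related)
  transfer (conj φ ψ)   (ok , ok′) related = transfer φ ok related ×-⇔ transfer ψ ok′ related
  transfer (disj φ ψ)   (ok , ok′) related = transfer φ ok related ⊎-⇔ transfer ψ ok′ related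
  transfer (ex x φ)     ok         related =
    Σ-⇔ (↔⇒↠ h) (transfer φ ok (related-update related (inj₂ x) refl))
  transfer (all x φ)    ok         related =
    Π-⇔ h (transfer φ ok (related-update related (inj₂ x) refl))
  transfer (bind a x φ) ok         related =
    transfer φ ok (related-update related (inj₁ a) (related (inj₂ x)))

  models-transfer : ∀ {φ} → OnlyRels Ok φ → Models Sig R φ ⇔ Models Sig R′ φ
  models-transfer {φ} ok = transfer φ ok (λ _ → refl)

ArityWiseIsomorphic : ∀ {Sig} → Structure Sig → Structure Sig → Set
ArityWiseIsomorphic {Sig} R R′ = ∀ r → Σ (D R ↔ D R′) λ h →
  ∀ {r′} → ar Sig r′ ≡ ar Sig r → ∀ g → interp R r′ g ⇔ interp R′ r′ (Inverse.to h ∘ g)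

-- Main lemma: arity-wise isomorphic structures satisfy the same OBFOL formulas. Each
-- component ℘♭r̄ mentions only relations of one arity S, so the bijection for S transfers it.
obfol-agree : ∀ {Sig} {R R′ : Structure Sig} → ArityWiseIsomorphic R R′ →
              ∀ {φ} → Frag Sig (OBody Sig) φ → Models Sig R φ ⇔ Models Sig R′ φ
obfol-agree {Sig} {R} {R′} iso (f-pre w _ (b , _ , ψ , (S , derived) , refl))
  with derived-witness derived
... | r , refl = Transfer.models-transfer R R′ (proj₁ (iso r)) (λ r′ → ar Sig r′ ≡ ar Sig r)
                   (proj₂ (iso r)) {applyQ Sig w (applyB Sig b ψ)}
                   (applyQ-only w (applyB-only b (derived-only derived)))
obfol-agree iso (f-conj φ ψ) = obfol-agree iso φ ×-⇔ obfol-agree iso ψ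
obfol-agree iso (f-disj φ ψ) = obfol-agree iso φ ⊎-⇔ obfol-agree iso ψ

separated⇒¬equivalent : ∀ {Sig} {R R′ : Structure Sig} {φ ψ} →
  Models Sig R φ → ¬ Models Sig R′ φ → (Models Sig R ψ ⇔ Models Sig R′ ψ) →
  ¬ Equivalent Sig φ ψ
separated⇒¬equivalent {R = R} {R′} R⊨φ R′⊭φ agree equivalent =
  R′⊭φ (proj₂ (equivalent R′) (to agree (proj₁ (equivalent R) R⊨φ)))

constantStructure : ∀ {Sig} {E : Set} → (Rel Sig → E) → Structure Sig
constantStructure {E = E} c = record
  { D          = E
  ; d₀         = c zero
  ; interp     = λ r g → ∀ i → g i ≡ c r
  ; interp-ext = λ r f g f≗g holds i → trans (sym (f≗g i)) (holds i)
  }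

constant-preserved : ∀ {Sig} {E E′ : Set} {c : Rel Sig → E} {c′ : Rel Sig → E′} {r}
  (h : E ↔ E′) → Inverse.to h (c r) ≡ c′ r → ∀ g →
  interp (constantStructure {Sig} c) r g ⇔ interp (constantStructure {Sig} c′) r (Inverse.to h ∘ g)
constant-preserved h hc≡c′ g = mk⇔
  (λ holds i → trans (cong (Inverse.to h) (holds i)) hc≡c′)
  (λ holds′ i → Injection.injective (Inverse⇒Injection h) (trans (holds′ i) (sym hc≡c′)))

Sig₂ : Signature
Sig₂ = record { na = 1 ; nr = 1 ; ar = ⁅_⁆ ; ar-nonempty = λ r → r , x∈⁅x⁆ r }

a b : Fin 2
a = zero
b = suc zero

-- Distinct relations of Sig₂ have distinct arities.
⁅⁆-injective : ∀ {n} {x y : Fin n} → ⁅ x ⁆ ≡ ⁅ y ⁆ → x ≡ y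
⁅⁆-injective {x = x} {y} eq = x∈⁅y⁆⇒x≡y y (subst (x ∈_) eq (x∈⁅x⁆ x))

value₂ : Fin 2 → Bool
value₂ zero       = true
value₂ (suc zero) = false

R₁ R₂ : Structure Sig₂
R₁ = constantStructure (λ _ → true)
R₂ = constantStructure value₂

flip : Fin 2 → Bool ↔ Bool
flip zero       = ↔-refl
flip (suc zero) = mk↔ₛ′ not not not-involutive not-involutive

-- flip r sends the R₁-value true of r to its R₂-value, and r is the only relation of its arity.
R₁≅R₂ : ArityWiseIsomorphic R₁ R₂
R₁≅R₂ r = flip r , λ {r′} same →
  constant-preserved {Sig = Sig₂} {c = λ _ → true} {c′ = value₂} {r = r′} (flip r)
    (trans (flips-true r) (cong value₂ (sym (⁅⁆-injective same))))
  where
  flips-true : ∀ r → Inverse.to (flip r) true ≡ value₂ r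
  flips-true zero       = refl
  flips-true (suc zero) = refl

obfol-R₁⇔R₂ : ∀ {ψ} → OBFOL-sentence Sig₂ ψ → Models Sig₂ R₁ ψ ⇔ Models Sig₂ R₂ ψ
obfol-R₁⇔R₂ (_ , frag) = obfol-agree R₁≅R₂ frag

x₀ : Var
x₀ = 0

_at_ : Fin 2 → Var → Formula Sig₂
r at x = bind r x (rel r)

φ∧ φ∨ : Formula Sig₂
φ∧ = ex  x₀ (conj (a at x₀) (b at x₀))
φ∨ = all x₀ (disj (a at x₀) (b at x₀))

OnlyFree : ∀ {Sig} → Var → Formula Sig → Set
OnlyFree {Sig} x φ = ∀ p → Free Sig p φ → p ≡ inj₂ x

-- (Free p φ unfolds only once p is split into an argument or a variable.)
conj-only : ∀ {Sig} {x} {φ ψ : Formula Sig} → OnlyFree x φ → OnlyFree x ψ → OnlyFree x (conj φ ψ)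
conj-only only only′ (inj₁ c) = [ only _ , only′ _ ]′
conj-only only only′ (inj₂ y) = [ only _ , only′ _ ]′

disj-only : ∀ {Sig} {x} {φ ψ : Formula Sig} → OnlyFree x φ → OnlyFree x ψ → OnlyFree x (disj φ ψ)
disj-only only only′ (inj₁ c) = [ only _ , only′ _ ]′
disj-only only only′ (inj₂ y) = [ only _ , only′ _ ]′

ex-closed : ∀ {Sig} {x} {φ : Formula Sig} → OnlyFree x φ → Sentence Sig (ex x φ)
ex-closed only (inj₁ c) (free , p≢x) = p≢x (only _ free)
ex-closed only (inj₂ y) (free , p≢x) = p≢x (only _ free)

all-closed : ∀ {Sig} {x} {φ : Formula Sig} → OnlyFree x φ → Sentence Sig (all x φ)
all-closed only (inj₁ c) (free , p≢x) = p≢x (only _ free)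
all-closed only (inj₂ y) (free , p≢x) = p≢x (only _ free)

-- The only free placeholder of (r, x) r is x: the argument r is bound to x.
at-only : ∀ r x → OnlyFree x (r at x)
at-only r x (inj₁ c) (inj₁ (c∈⁅r⁆ , c≢r)) = ⊥-elim (c≢r (cong inj₁ (x∈⁅y⁆⇒x≡y r c∈⁅r⁆)))
at-only r x (inj₁ c) (inj₂ (_ , p≡x))     = p≡x
at-only r x (inj₂ y) (inj₁ (() , _))
at-only r x (inj₂ y) (inj₂ (_ , p≡x))     = p≡x

φ∧-closed : Sentence Sig₂ φ∧
φ∧-closed = ex-closed (conj-only (at-only a x₀) (at-only b x₀))

φ∨-closed : Sentence Sig₂ φ∨
φ∨-closed = all-closed (disj-only (at-only a x₀) (at-only b x₀))

at-bound-derived : ∀ r x → BoundDerived Sig₂ (r at x)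
at-bound-derived r x = (r , x) ∷ [] , [] ∷ [] , rel r , (⁅ r ⁆ , d-rel r refl) , refl

single-quantifier : ∀ q x → IsQPrefix Sig₂ ((q , x) ∷ [])
single-quantifier q x = [] ∷ []

φ∧-CBFOL : Frag Sig₂ (CBody Sig₂) φ∧
φ∧-CBFOL = f-pre ((∃q , x₀) ∷ []) (single-quantifier ∃q x₀)
  (cb-conj (cb-atom (at-bound-derived a x₀)) (cb-atom (at-bound-derived b x₀)))

φ∨-DBFOL : Frag Sig₂ (DBody Sig₂) φ∨
φ∨-DBFOL = f-pre ((∀q , x₀) ∷ []) (single-quantifier ∀q x₀)
  (db-disj (db-atom (at-bound-derived a x₀)) (db-atom (at-bound-derived b x₀)))

at-sat : ∀ {E : Set} (c : Fin 2 → E) r x χ {d} → χ (inj₂ x) ≡ just d →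
         Sat Sig₂ (constantStructure c) χ (r at x) ⇔ (d ≡ c r)
at-sat {E} c r x χ {d} χx≡d = mk⇔
  (λ (g , defined , holds) →
     trans (just-injective (trans (sym χx≡d)
             (trans (sym (reads-x (r , x∈⁅x⁆ r))) (defined (r , x∈⁅x⁆ r)))))
           (holds (r , x∈⁅x⁆ r)))
  (λ d≡cr → (λ _ → d) , (λ i → trans (reads-x i) χx≡d) , (λ _ → d≡cr))
  where
  R = constantStructure c
  reads-x : ∀ (i : ArgsOf Sig₂ r) →
            update Sig₂ R χ (inj₁ r) (χ (inj₂ x)) (inj₁ (proj₁ i)) ≡ χ (inj₂ x)
  reads-x (c′ , c′∈⁅r⁆) with x∈⁅y⁆⇒x≡y r c′∈⁅r⁆
  ... | refl = update-same R χ (inj₁ r) (χ (inj₂ x))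
  just-injective : ∀ {u v : E} → just u ≡ just v → u ≡ v
  just-injective refl = refl

at-x₀ : ∀ {E : Set} (c : Fin 2 → E) r d →
        let R = constantStructure c in
        Sat Sig₂ R (update Sig₂ R (λ _ → nothing) (inj₂ x₀) (just d)) (r at x₀) ⇔ (d ≡ c r)
at-x₀ c r d =
  at-sat c r x₀ _ (update-same {Sig₂} (constantStructure c) (λ _ → nothing) (inj₂ x₀) (just d))

-- In R₁ the value true witnesses φ∧; in R₂ no value satisfies r_a (= true) and r_b (= false).
R₁⊨φ∧ : Models Sig₂ R₁ φ∧
R₁⊨φ∧ = true , from (at-x₀ _ a true) refl , from (at-x₀ _ b true) refl

R₂⊭φ∧ : ¬ Models Sig₂ R₂ φ∧
R₂⊭φ∧ (d , at-a , at-b)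
  with trans (sym (to (at-x₀ value₂ a d) at-a)) (to (at-x₀ value₂ b d) at-b)
... | ()

-- In R₂ every value satisfies r_a or r_b; in R₁ the value false satisfies neither.
R₂⊨φ∨ : Models Sig₂ R₂ φ∨
R₂⊨φ∨ true  = inj₁ (from (at-x₀ value₂ a true) refl)
R₂⊨φ∨ false = inj₂ (from (at-x₀ value₂ b false) refl)

R₁⊭φ∨ : ¬ Models Sig₂ R₁ φ∨
R₁⊭φ∨ all-sat with all-sat false
... | inj₁ at-a with to (at-x₀ _ a false) at-a
...   | ()
R₁⊭φ∨ all-sat | inj₂ at-b with to (at-x₀ _ b false) at-b
...   | ()

mainTheorem5 : ((Sig : Signature) → (φ : Formula Sig) → OBFOL-sentence Sig φ → CBFOL-sentence Sig φ × DBFOL-sentence Sig φ)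
    × Σ Signature (λ Sig →
        Σ (Formula Sig) (λ φ → CBFOL-sentence Sig φ × ((ψ : Formula Sig) → OBFOL-sentence Sig ψ → ¬ Equivalent Sig φ ψ))
        × Σ (Formula Sig) (λ φ → DBFOL-sentence Sig φ × ((ψ : Formula Sig) → OBFOL-sentence Sig ψ → ¬ Equivalent Sig φ ψ)))
mainTheorem5 =
    (λ Sig φ obfol → OBFOL⊆CBFOL Sig obfol , OBFOL⊆DBFOL Sig obfol)
  , Sig₂
  , (φ∧ , (φ∧-closed , φ∧-CBFOL)
        , λ ψ obfol → separated⇒¬equivalent {R = R₁} {R₂} {φ∧} {ψ} R₁⊨φ∧ R₂⊭φ∧ (obfol-R₁⇔R₂ {ψ} obfol))
  , (φ∨ , (φ∨-closed , φ∨-DBFOL)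
        , λ ψ obfol → separated⇒¬equivalent {R = R₂} {R₁} {φ∨} {ψ} R₂⊨φ∨ R₁⊭φ∨ (⇔-sym (obfol-R₁⇔R₂ {ψ} obfol)))
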